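{- Let $F$ be a uniformly sign-coherent ice quiver whose mutable subquiver is a fork with point of return $r$, and let $v_1\prec\dots\prec v_{n-1}$ be the unique acyclic ordering of the mutable subquiver minus $r$. Pick $v_j$, $j\in\{1,\dots,n-1\}$, and let $F'=\mu_{v_j}(F)$. (i) If $v_j$ is blue in $F$, then the color of every mutable vertex is unchanged after mutation. (ii) If $v_j$ is green in $F$, then the color of every $v_i$ with $v_j\prec v_i$ is unchanged, the color of $r$ is unchanged if $v_j\in F^-(r)$, and $v_j$ is red in $F'$. (iii) If $v_j$ is red in $F$, then the color of every $v_i$ with $v_i\prec v_j$ is unchanged, the color of $r$ is unchanged if $v_j\in F^+(r)$, and $v_j$ is green in $F'$.
   Context: Quivers have no loops or 2-cycles; $f_{ij}$ is the number of arrows $i\to j$, negative if arrows go $j\to i$. An ice quiver has vertices partitioned into mutable and frozen; its mutable subquiver is the full subquiver on mutable vertices. Mutation at a mutable vertex $k$: add an arrow $a\to b$ for each path $a\to k\to b$, reverse all arrows at $k$, remove 2-cycles. A mutable vertex $i$ is green if it has at least one arrow to/from a frozen vertex and all such arrows go from $i$ to frozen vertices; red if at least one such arrow and all go from frozen vertices to $i$; blue if none. Uniformly sign-coherent: every ice quiver obtained by mutation sequences has every mutable vertex red, green or blue, and not every mutable vertex of the ice quiver itself is blue. Abundant: at least two arrows between every pair of distinct vertices; acyclic: no directed cycle. An acyclic ordering: total order $\prec$ with $v_i\prec v_j$ whenever $v_i\to v_j$. A fork is an abundant, non-acyclic quiver $F$ with a vertex $r$ (point of return) such that for all $i\in F^-(r)$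 (vertices with arrows to $r$) and $j\in F^+(r)$ (vertices with arrows from $r$), $f_{ji}>f_{ir}$ and $f_{ji}>f_{rj}$, and $F\setminus\{r\}$ (full subquiver on the other vertices) is acyclic. -}

module Defs where

open import Data.Nat as ℕ using (ℕ; suc)
open import Data.Integer using (ℤ; 0ℤ; _+_; _-_; _*_; -_; _⊔_; _<_; _≤_; ∣_∣)
open import Data.Fin using (Fin)
import Data.Fin.Properties as FinP
open import Data.Sum using (_⊎_; inj₁; inj₂)
open import Data.Sum.Properties using (≡-dec)
open import Data.Product using (Σ; ∃; _×_; _,_)
open import Data.List using (List; []; _∷_)
open import Data.Empty using (⊥)
open import Relation.Nullary using (¬_; yes; no)
open import Relation.Binary.PropositionalEquality using (_≡_; _≢_)
open import Relation.Binary.Construct.Closure.Transitive using (TransClosure)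

-- An ice quiver with n mutable vertices (inj₁) and m frozen vertices (inj₂),
-- given by its signed arrow-count function f a b (= #arrows a→b, negative if b→a).
Vertex : ℕ → ℕ → Set
Vertex n m = Fin n ⊎ Fin m

IceQuiver : ℕ → ℕ → Set
IceQuiver n m = Vertex n m → Vertex n m → ℤ

-- Well-formedness: no loops / no 2-cycles encoded as skew-symmetry (forces f a a = 0).
IsQuiver : ∀ {n m} → IceQuiver n m → Set
IsQuiver F = ∀ a b → F a b ≡ - F b a

pos : ℤ → ℤ
pos x = x ⊔ 0ℤ

-- Mutation at vertex k (quiver mutation written on signed arrow counts):
-- arrows at k reversed; otherwise add #(a→k→b) and subtract #(b→k→a); 2-cycles cancel.
mutate : ∀ {n m} → IceQuiver n m → Fin n → IceQuiver n m
mutate {n} {m} F k a b with ≡-dec FinP._≟_ FinP._≟_ a (inj₁ k) | ≡-dec FinP._≟_ FinP._≟_ b (inj₁ k)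
... | yes _ | _     = - F a b
... | no _  | yes _ = - F a b
... | no _  | no _  = F a b + pos (F a (inj₁ k)) * pos (F (inj₁ k) b)
                        - pos (- F a (inj₁ k)) * pos (- F (inj₁ k) b)

mutateSeq : ∀ {n m} → List (Fin n) → IceQuiver n m → IceQuiver n m
mutateSeq []       F = F
mutateSeq (k ∷ ks) F = mutateSeq ks (mutate F k)

Green : ∀ {n m} → IceQuiver n m → Fin n → Set
Green F i = (∃ λ (a : Fin _) → 0ℤ < F (inj₁ i) (inj₂ a)) × (∀ a → 0ℤ ≤ F (inj₁ i) (inj₂ a))

Red : ∀ {n m} → IceQuiver n m → Fin n → Set
Red F i = (∃ λ (a : Fin _) → F (inj₁ i) (inj₂ a) < 0ℤ) × (∀ a → F (inj₁ i) (inj₂ a) ≤ 0ℤ)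

Blue : ∀ {n m} → IceQuiver n m → Fin n → Set
Blue F i = ∀ a → F (inj₁ i) (inj₂ a) ≡ 0ℤ

data Colour : Set where
  green red blue : Colour

HasColour : ∀ {n m} → IceQuiver n m → Fin n → Colour → Set
HasColour F i green = Green F i
HasColour F i red   = Red F i
HasColour F i blue  = Blue F i

SameColour : ∀ {n m} → IceQuiver n m → IceQuiver n m → Fin n → Set
SameColour F F' i = ∀ c → (HasColour F i c → HasColour F' i c) × (HasColour F' i c → HasColour F i c)

UniformlySignCoherent : ∀ {n m} → IceQuiver n m → Set
UniformlySignCoherent F =
  (∀ (ks : List (Fin _)) i → ∃ λ c → HasColour (mutateSeq ks F) i c)
  × ¬ (∀ i → Blue F i)

Quiver : ℕ → Set
Quiver n = Fin n → Fin n → ℤ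

mutableSub : ∀ {n m} → IceQuiver n m → Quiver n
mutableSub F i j = F (inj₁ i) (inj₁ j)

Arrow : ∀ {n} → Quiver n → Fin n → Fin n → Set
Arrow Q a b = 0ℤ < Q a b

Abundant : ∀ {n} → Quiver n → Set
Abundant Q = ∀ i j → i ≢ j → 2 ℕ.≤ ∣ Q i j ∣

Acyclic : ∀ {n} → Quiver n → Set
Acyclic Q = ∀ a → ¬ TransClosure (Arrow Q) a a

ArrowWithout : ∀ {n} → Quiver n → Fin n → Fin n → Fin n → Set
ArrowWithout Q r a b = a ≢ r × b ≢ r × Arrow Q a b

AcyclicWithout : ∀ {n} → Quiver n → Fin n → Set
AcyclicWithout Q r = ∀ a → a ≢ r → ¬ TransClosure (ArrowWithout Q r) a a

IsFork : ∀ {n} → Quiver n → Fin n → Set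
IsFork Q r =
  Abundant Q × ¬ Acyclic Q
  × (∀ i j → Arrow Q i r → Arrow Q r j → (Q i r < Q j i) × (Q r j < Q j i))
  × AcyclicWithout Q r

-- v : Fin k → Fin (suc k) enumerates Q ∖ {r} as v₁ ≺ … ≺ v_k in an acyclic ordering
-- (index order is the ordering ≺).
IsAcyclicOrdering : ∀ {k} → Quiver (suc k) → Fin (suc k) → (Fin k → Fin (suc k)) → Set
IsAcyclicOrdering {k} Q r v =
  (∀ i j → v i ≡ v j → i ≡ j)
  × (∀ i → v i ≢ r)
  × (∀ i j → Arrow Q (v i) (v j) → i Data.Fin.< j)

module Submission where

-- Mutation at k changes the arrows from x ≠ k to a frozen vertex a only by the
-- paths x → k → a (added) and a → k → x (removed).  If k is green and there is
-- no arrow x → k, neither kind of path exists, so the frozen arrows at x, hence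
-- its colour, are untouched; dually when k is red and there is no arrow k → x.
-- An acyclic ordering forbids arrows from later to earlier vertices, and for r
-- the arrow between r and k is given by hypothesis.  The frozen arrows at k
-- itself are reversed, which swaps green and red.

open import Defs
open import Data.Nat using (suc)
open import Data.Fin using (Fin; _<_)
import Data.Fin.Properties as FinP
open import Data.Product using (_×_; _,_)
open import Data.Sum using (inj₁; inj₂)
open import Data.Integer using (0ℤ; _+_; _-_; _*_; -_; _≤_)
import Data.Integer as ℤ
import Data.Integer.Properties as ℤP
open import Relation.Nullary using (Dec; yes; no)
open import Relation.Binary.PropositionalEquality
open import Data.Empty using (⊥-elim)

pos-nonpos : ∀ {x} → x ≤ 0ℤ → pos x ≡ 0ℤ
pos-nonpos = ℤP.i≤j⇒i⊔j≡j

reverse-nonneg : ∀ {n m} {F : IceQuiver n m} → IsQuiver F → ∀ {a b} → 0ℤ ≤ F a b → F b a ≤ 0ℤ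
reverse-nonneg {F = F} isQ {a} {b} 0≤Fab rewrite isQ b a = ℤP.neg-mono-≤ 0≤Fab

reverse-nonpos : ∀ {n m} {F : IceQuiver n m} → IsQuiver F → ∀ {a b} → F a b ≤ 0ℤ → 0ℤ ≤ F b a
reverse-nonpos {F = F} isQ {a} {b} Fab≤0 rewrite isQ b a = ℤP.neg-mono-≤ Fab≤0

mutate-at : ∀ {n m} (F : IceQuiver n m) k b → mutate F k (inj₁ k) b ≡ - F (inj₁ k) b
mutate-at F k b with k FinP.≟ k
... | yes _ = refl
... | no k≢k = ⊥-elim (k≢k refl)

mutate-frozen : ∀ {n m} (F : IceQuiver n m) {k x} → x ≢ k → ∀ a →
  mutate F k (inj₁ x) (inj₂ a)
    ≡ F (inj₁ x) (inj₂ a) + pos (F (inj₁ x) (inj₁ k)) * pos (F (inj₁ k) (inj₂ a))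
                          - pos (- F (inj₁ x) (inj₁ k)) * pos (- F (inj₁ k) (inj₂ a))
mutate-frozen F {k} {x} x≢k a with x FinP.≟ k
... | yes x≡k = ⊥-elim (x≢k x≡k)
... | no _ = refl

mutate-frozen-fixed : ∀ {n m} (F : IceQuiver n m) {k x} → x ≢ k → ∀ a
  → pos (F (inj₁ x) (inj₁ k)) * pos (F (inj₁ k) (inj₂ a)) ≡ 0ℤ
  → pos (- F (inj₁ x) (inj₁ k)) * pos (- F (inj₁ k) (inj₂ a)) ≡ 0ℤ
  → mutate F k (inj₁ x) (inj₂ a) ≡ F (inj₁ x) (inj₂ a)
mutate-frozen-fixed F {k} {x} x≢k a in≡0 out≡0 = begin
  mutate F k (inj₁ x) (inj₂ a)    ≡⟨ mutate-frozen F x≢k a ⟩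
  Fxa + _ - _                     ≡⟨ cong₂ (λ p q → Fxa + p - q) in≡0 out≡0 ⟩
  Fxa + 0ℤ - 0ℤ                   ≡⟨ ℤP.+-identityʳ (Fxa + 0ℤ) ⟩
  Fxa + 0ℤ                        ≡⟨ ℤP.+-identityʳ Fxa ⟩
  Fxa                             ∎
  where
  open ≡-Reasoning
  Fxa = F (inj₁ x) (inj₂ a)

mutate-atGreen-fixed : ∀ {n m} (F : IceQuiver n m) {k x} → x ≢ k
  → (∀ a → 0ℤ ≤ F (inj₁ k) (inj₂ a)) → F (inj₁ x) (inj₁ k) ≤ 0ℤ
  → ∀ a → mutate F k (inj₁ x) (inj₂ a) ≡ F (inj₁ x) (inj₂ a)
mutate-atGreen-fixed F {k} {x} x≢k 0≤Fk Fxk≤0 a = mutate-frozen-fixed F x≢k a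
  (cong (_* pos (F (inj₁ k) (inj₂ a))) (pos-nonpos Fxk≤0))
  (trans (cong (pos (- F (inj₁ x) (inj₁ k)) *_) (pos-nonpos (ℤP.neg-mono-≤ (0≤Fk a))))
         (ℤP.*-zeroʳ (pos (- F (inj₁ x) (inj₁ k)))))

mutate-atRed-fixed : ∀ {n m} (F : IceQuiver n m) {k x} → x ≢ k
  → (∀ a → F (inj₁ k) (inj₂ a) ≤ 0ℤ) → 0ℤ ≤ F (inj₁ x) (inj₁ k)
  → ∀ a → mutate F k (inj₁ x) (inj₂ a) ≡ F (inj₁ x) (inj₂ a)
mutate-atRed-fixed F {k} {x} x≢k Fk≤0 0≤Fxk a = mutate-frozen-fixed F x≢k a
  (trans (cong (pos (F (inj₁ x) (inj₁ k)) *_) (pos-nonpos (Fk≤0 a)))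
         (ℤP.*-zeroʳ (pos (F (inj₁ x) (inj₁ k)))))
  (cong (_* pos (- F (inj₁ k) (inj₂ a))) (pos-nonpos (ℤP.neg-mono-≤ 0≤Fxk)))

mutate-atBlue-fixed : ∀ {n m} (F : IceQuiver n m) {k} → Blue F k
  → ∀ x a → mutate F k (inj₁ x) (inj₂ a) ≡ F (inj₁ x) (inj₂ a)
mutate-atBlue-fixed F {k} k-blue x a = fixed (x FinP.≟ k)
  where
  fixed : Dec (x ≡ k) → mutate F k (inj₁ x) (inj₂ a) ≡ F (inj₁ x) (inj₂ a)
  fixed (yes refl) = trans (mutate-at F k (inj₂ a)) (trans (cong -_ (k-blue a)) (sym (k-blue a)))
  fixed (no x≢k) with ℤP.≤-total (F (inj₁ x) (inj₁ k)) 0ℤ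
  ... | inj₁ Fxk≤0 = mutate-atGreen-fixed F x≢k (λ b → ℤP.≤-reflexive (sym (k-blue b))) Fxk≤0 a
  ... | inj₂ 0≤Fxk = mutate-atRed-fixed F x≢k (λ b → ℤP.≤-reflexive (k-blue b)) 0≤Fxk a

frozenRow≡⇒sameColour : ∀ {n m} (F F' : IceQuiver n m) x
  → (∀ a → F' (inj₁ x) (inj₂ a) ≡ F (inj₁ x) (inj₂ a)) → SameColour F F' x
frozenRow≡⇒sameColour F F' x eq c = transport c (λ a → sym (eq a)) , transport c eq
  where
  transport : ∀ c {G G' : IceQuiver _ _} → (∀ a → G (inj₁ x) (inj₂ a) ≡ G' (inj₁ x) (inj₂ a))
    → HasColour G x c → HasColour G' x c
  transport green e ((a , p) , q) = (a , subst (0ℤ ℤ.<_) (e a) p) , λ b → subst (0ℤ ≤_) (e b) (q b)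
  transport red   e ((a , p) , q) = (a , subst (ℤ._< 0ℤ) (e a) p) , λ b → subst (_≤ 0ℤ) (e b) (q b)
  transport blue  e q             = λ b → trans (sym (e b)) (q b)

mutate-green⇒red : ∀ {n m} (F : IceQuiver n m) {k} → Green F k → Red (mutate F k) k
mutate-green⇒red F {k} ((a , p) , q) =
    (a , subst (ℤ._< 0ℤ) (sym (mutate-at F k (inj₂ a))) (ℤP.neg-mono-< p))
  , λ b → subst (_≤ 0ℤ) (sym (mutate-at F k (inj₂ b))) (ℤP.neg-mono-≤ (q b))

mutate-red⇒green : ∀ {n m} (F : IceQuiver n m) {k} → Red F k → Green (mutate F k) k
mutate-red⇒green F {k} ((a , p) , q) =
    (a , subst (0ℤ ℤ.<_) (sym (mutate-at F k (inj₂ a))) (ℤP.neg-mono-< p))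
  , λ b → subst (0ℤ ≤_) (sym (mutate-at F k (inj₂ b))) (ℤP.neg-mono-≤ (q b))

acyclicOrdering-noBackwardArrow : ∀ {k} (Q : Quiver (suc k)) {r v} → IsAcyclicOrdering Q r v
  → ∀ {i j} → i < j → Q (v j) (v i) ≤ 0ℤ
acyclicOrdering-noBackwardArrow _ (_ , _ , ordered) {i} {j} i<j =
  ℤP.≮⇒≥ (λ arrow → FinP.<-asym i<j (ordered j i arrow))

acyclicOrdering-distinct : ∀ {k} (Q : Quiver (suc k)) {r v} → IsAcyclicOrdering Q r v
  → ∀ {i j} → i < j → v i ≢ v j
acyclicOrdering-distinct _ (injective , _ , _) i<j vi≡vj = FinP.<-irrefl (injective _ _ vi≡vj) i<j

corollary4p3 : ∀ {k m} (F : IceQuiver (suc k) m) (r : Fin (suc k)) (v : Fin k → Fin (suc k))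
    → IsQuiver F
    → UniformlySignCoherent F
    → IsFork (mutableSub F) r
    → IsAcyclicOrdering (mutableSub F) r v
    → (j : Fin k)
    → (Blue F (v j) → ∀ x → SameColour F (mutate F (v j)) x)
      × (Green F (v j)
          → (∀ i → j < i → SameColour F (mutate F (v j)) (v i))
            × (Arrow (mutableSub F) (v j) r → SameColour F (mutate F (v j)) r)
            × Red (mutate F (v j)) (v j))
      × (Red F (v j)
          → (∀ i → i < j → SameColour F (mutate F (v j)) (v i))
            × (Arrow (mutableSub F) r (v j) → SameColour F (mutate F (v j)) r)
            × Green (mutate F (v j)) (v j))
corollary4p3 F r v isQ _ _ ord@(_ , v≢r , _) j = blueCase , greenCase , redCase
  where
  unchanged : ∀ x → (∀ a → mutate F (v j) (inj₁ x) (inj₂ a) ≡ F (inj₁ x) (inj₂ a))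
    → SameColour F (mutate F (v j)) x
  unchanged = frozenRow≡⇒sameColour F (mutate F (v j))
  noBackwardArrow : ∀ {i i'} → i < i' → F (inj₁ (v i')) (inj₁ (v i)) ≤ 0ℤ
  noBackwardArrow = acyclicOrdering-noBackwardArrow (mutableSub F) ord
  distinct : ∀ {i i'} → i < i' → v i ≢ v i'
  distinct = acyclicOrdering-distinct (mutableSub F) ord
  r≢vj : r ≢ v j
  r≢vj r≡vj = v≢r j (sym r≡vj)

  blueCase : Blue F (v j) → ∀ x → SameColour F (mutate F (v j)) x
  blueCase vj-blue x = unchanged x (mutate-atBlue-fixed F vj-blue x)

  greenCase : Green F (v j)
    → (∀ i → j < i → SameColour F (mutate F (v j)) (v i))
      × (Arrow (mutableSub F) (v j) r → SameColour F (mutate F (v j)) r)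
      × Red (mutate F (v j)) (v j)
  greenCase vj-green@(_ , 0≤Fvj) =
      (λ i j<i → unchanged (v i) (mutate-atGreen-fixed F
          (≢-sym (distinct j<i)) 0≤Fvj (noBackwardArrow j<i)))
    , (λ vj→r → unchanged r (mutate-atGreen-fixed F r≢vj 0≤Fvj (reverse-nonneg isQ (ℤP.<⇒≤ vj→r))))
    , mutate-green⇒red F vj-green

  redCase : Red F (v j)
    → (∀ i → i < j → SameColour F (mutate F (v j)) (v i))
      × (Arrow (mutableSub F) r (v j) → SameColour F (mutate F (v j)) r)
      × Green (mutate F (v j)) (v j)
  redCase vj-red@(_ , Fvj≤0) =
      (λ i i<j → unchanged (v i) (mutate-atRed-fixed F
          (distinct i<j) Fvj≤0
          (reverse-nonpos isQ (noBackwardArrow i<j))))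
    , (λ r→vj → unchanged r (mutate-atRed-fixed F r≢vj Fvj≤0 (ℤP.<⇒≤ r→vj)))
    , mutate-red⇒green F vj-red
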